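{- For $n\in\mathbb{N}$ and $t\in(0,\infty)$ let $B_n(t) := \sum_{(\pi,u)\in NC^{\mathrm{(mton)}}(n)} t^{|\pi|}$. Then $B_n(t) = (1+nt)\,B_{n-1}(t)$ for all $n\ge2$, and consequently $B_n(t) = t(1+2t)(1+3t)\cdots(1+nt)$ for $n\ge 2$ and $t\in(0,\infty)$.
   Context: $NC(n)$: non-crossing partitions of $\{1,\ldots,n\}$. For blocks $V,W$, "$V$ nested inside $W$" means $\min V>\min W$ and $\max V<\max W$. A monotonic ordering of $\pi\in NC(n)$ is a bijection $u:\pi\to\{1,\ldots,|\pi|\}$ with $u(V)>u(W)$ whenever $V$ is nested inside $W$. $NC^{\mathrm{(mton)}}(n)$ is the set of pairs $(\pi,u)$ with $\pi\in NC(n)$ and $u$ a monotonic ordering of $\pi$; $|\pi|$ is the number of blocks. -}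

module Defs where

open import Level using (Level)
open import Data.Nat as ℕ using (ℕ; zero; suc)
open import Data.Fin using (Fin; _<_)
open import Data.Vec using (Vec; lookup)
open import Data.Product using (Σ; ∃; ∃-syntax; _×_; _,_; proj₁)
open import Data.List using (List; foldr)
open import Data.List.Membership.Propositional using (_∈_)
open import Data.List.Relation.Unary.All using (All)
open import Data.List.Relation.Unary.Unique.Propositional using (Unique)
open import Relation.Binary.PropositionalEquality using (_≡_)
open import Algebra.Bundles using (CommutativeSemiring)

-- A pair (π , u) with π a partition of {1..n} into k blocks and
-- u : π → {1..k} a bijection is the same thing as a surjective labelling
-- ℓ : {1..n} → {1..k}: the blocks of π are the fibres of ℓ and
-- u(block) = its label.  Positions are Fin n (i.e. 0..n-1, same order),
-- labels are Fin k (0-based, same order).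

Labelling : ℕ → Set
Labelling n = Σ ℕ (λ k → Vec (Fin k) n)

module _ {n k : ℕ} (ℓ : Vec (Fin k) n) where

  Surj : Set
  Surj = (j : Fin k) → ∃[ i ] lookup ℓ i ≡ j

  NonCrossing : Set
  NonCrossing = (a b c d : Fin n) → a < b → b < c → c < d →
                lookup ℓ a ≡ lookup ℓ c → lookup ℓ b ≡ lookup ℓ d →
                lookup ℓ a ≡ lookup ℓ b

  -- block V (label j) nested inside block W (label j'):
  -- min V > min W  and  max V < max W  (written out elementwise)
  NestedIn : Fin k → Fin k → Set
  NestedIn j j' =
    (∃[ w ] (lookup ℓ w ≡ j' × ((v : Fin n) → lookup ℓ v ≡ j → w < v))) ×
    (∃[ w ] (lookup ℓ w ≡ j' × ((v : Fin n) → lookup ℓ v ≡ j → v < w)))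

  Monotonic : Set
  Monotonic = (j j' : Fin k) → NestedIn j j' → j' < j

IsNCmton : ∀ {n} → Labelling n → Set
IsNCmton (k , ℓ) = Surj ℓ × NonCrossing ℓ × Monotonic ℓ

IsEnumeration : ∀ {n} → List (Labelling n) → Set
IsEnumeration {n} L =
  Unique L × All IsNCmton L × ((x : Labelling n) → IsNCmton x → x ∈ L)

module _ {c ℓ' : Level} (R : CommutativeSemiring c ℓ') where
  open CommutativeSemiring R

  pow : Carrier → ℕ → Carrier
  pow x zero = 1#
  pow x (suc m) = x * pow x m

  times : ℕ → Carrier → Carrier
  times zero x = 0#
  times (suc m) x = x + times m x

  Bsum : ∀ {n} → Carrier → List (Labelling n) → Carrier
  Bsum t L = foldr (λ x acc → pow t (proj₁ x) + acc) 0# L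

  -- t (1+2t)(1+3t)⋯(1+nt)   (for n ≥ 1; value at 0 irrelevant)
  closedForm : Carrier → ℕ → Carrier
  closedForm t zero = 1#
  closedForm t (suc zero) = t
  closedForm t (suc (suc m)) = closedForm t (suc m) * (1# + times (suc (suc m)) t)

-- Classify an element of NC^(mton)(n+1) by its top block, the block carrying the largest label. Monotonicity makes
-- the top block an interval: a block lying between two of its elements would be nested in it, hence carry a larger
-- label. If the top block is a singleton, deleting it leaves an element of NC^(mton)(n) with one block fewer;
-- conversely a singleton with a new largest label can be inserted at any of the n+1 positions, since a singleton
-- encloses nothing and no label exceeds the new one. Otherwise the first two elements of the top block are adjacent,
-- and merging them gives an element of NC^(mton)(n) with the same number of blocks. Hence
-- B_{n+1}(t) = (1 + (n+1)t) B_n(t), and the product formula follows from B_1(t) = t.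

module Submission where

open import Defs
open import Level using (Level)
open import Function using (_∘_; _⇔_; mk⇔; Equivalence; Surjective)
open import Data.Empty using (⊥-elim)
open import Data.Product using (Σ; ∃; ∃-syntax; ∃₂; _×_; _,_; proj₁; proj₂)
open import Data.Product.Properties using (,-injectiveˡ)
open import Data.Product.Properties.WithK using (,-injectiveʳ)
open import Data.Sum using (_⊎_; inj₁; inj₂)
open import Data.Nat as ℕ using (ℕ; zero; suc; _≤_; _∸_; z≤n; s≤s)
import Data.Nat.Properties as ℕ
open import Data.Fin as Fin using (Fin; zero; suc; toℕ; fromℕ; inject₁; punchIn; punchOut; pinch; _<_)
open import Data.Fin.Properties
  using (_≟_; <-cmp; <-asym; <-trans; <⇒≢; ≤∧≢⇒<; ≤-refl; ≤fromℕ; fromℕ≢inject₁; any?;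
         inject₁-injective; toℕ-inject₁; ≤̄⇒inject₁<;
         punchIn-injective; punchInᵢ≢i; punchIn-mono-≤; punchIn-cancel-≤; punchIn-punchOut;
         pinch-mono-≤; pinch-surjective)
open import Data.Fin.Relation.Unary.Top using (view; ‵fromℕ; ‵inject₁)
open import Data.Vec as Vec using (Vec; []; _∷_; lookup; insertAt; removeAt)
open import Data.Vec.Properties
  using (insertAt-lookup; insertAt-punchIn; insertAt-removeAt; removeAt-insertAt; lookup-map;
         ∷-injectiveˡ; ∷-injectiveʳ)
open import Data.List using (List; []; _∷_; _++_; map; foldr; cartesianProductWith; allFin; length)
open import Data.List.Properties using (foldr-map; length-tabulate)
open import Data.List.Membership.Propositional using (_∈_)
open import Data.List.Membership.Propositional.Properties
  using (∈-map⁺; ∈-map⁻; ∈-++⁺ˡ; ∈-++⁺ʳ; ∈-++⁻; ∈-allFin;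
         ∈-cartesianProductWith⁺; ∈-cartesianProductWith⁻)
open import Data.List.Membership.Propositional.Properties.WithK using (unique∧set⇒bag)
open import Data.List.Relation.Unary.All as All using ()
open import Data.List.Relation.Unary.Any using (here)
open import Data.List.Relation.Unary.AllPairs as AllPairs using ()
import Data.List.Relation.Unary.Unique.Propositional.Properties as Unique
open import Data.List.Relation.Binary.BagAndSetEquality using (∼bag⇒↭)
open import Data.List.Relation.Binary.Permutation.Propositional using (_↭_; ↭⇒↭ₛ′)
import Data.List.Relation.Binary.Permutation.Propositional.Properties as ↭
import Data.List.Relation.Binary.Permutation.Setoid.Properties as ↭ₛ
open import Algebra.Bundles using (CommutativeSemiring)
open import Relation.Nullary using (¬_; yes; no)
open import Relation.Nullary.Decidable using (¬?; _×-dec_; decidable-stable)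
open import Relation.Binary using (tri<; tri≈; tri>)
open import Relation.Binary.Definitions using (DecidableEquality)
import Relation.Binary.Reasoning.Setoid as SetoidReasoning
open import Relation.Binary.PropositionalEquality
  using (_≡_; _≢_; refl; sym; trans; cong; cong₂; subst; subst₂; module ≡-Reasoning)

inject₁-mono-< : ∀ {n} {i j : Fin n} → i < j → inject₁ i < inject₁ j
inject₁-mono-< {i = i} {j} = subst₂ ℕ._<_ (sym (toℕ-inject₁ i)) (sym (toℕ-inject₁ j))

inject₁-cancel-< : ∀ {n} {i j : Fin n} → inject₁ i < inject₁ j → i < j
inject₁-cancel-< {i = i} {j} = subst₂ ℕ._<_ (toℕ-inject₁ i) (toℕ-inject₁ j)

inject₁<fromℕ : ∀ {n} (i : Fin n) → inject₁ i < fromℕ n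
inject₁<fromℕ i = ≤∧≢⇒< (≤fromℕ _) (fromℕ≢inject₁ ∘ sym)

fromℕ≮ : ∀ {n} (i : Fin (suc n)) → ¬ fromℕ n < i
fromℕ≮ i fromℕ<i = ℕ.<⇒≱ fromℕ<i (≤fromℕ i)

punchIn-mono-< : ∀ {n} (p : Fin (suc n)) {i j : Fin n} → i < j → punchIn p i < punchIn p j
punchIn-mono-< p {i} {j} i<j =
  ≤∧≢⇒< (punchIn-mono-≤ p i j (ℕ.<⇒≤ i<j)) (<⇒≢ i<j ∘ punchIn-injective p i j)

punchIn-cancel-< : ∀ {n} (p : Fin (suc n)) {i j : Fin n} → punchIn p i < punchIn p j → i < j
punchIn-cancel-< p {i} {j} lt =
  ≤∧≢⇒< (punchIn-cancel-≤ p i j (ℕ.<⇒≤ lt)) (<⇒≢ lt ∘ cong (punchIn p))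

data PunchView {n} (p : Fin (suc n)) : Fin (suc n) → Set where
  at-p    : PunchView p p
  punched : (j : Fin n) → PunchView p (punchIn p j)

punchView : ∀ {n} (p x : Fin (suc n)) → PunchView p x
punchView p x with p ≟ x
... | yes refl = at-p
... | no p≢x   = subst (PunchView p) (punchIn-punchOut p≢x) (punched (punchOut p≢x))

data Side : Set where
  left right : Side

_⟨_⟩_ : ∀ {n} → Fin n → Side → Fin n → Set
x ⟨ left  ⟩ y = x < y
x ⟨ right ⟩ y = y < x

-- `NestedIn ℓ j j′` unfolds to `Fence ℓ left j j′ × Fence ℓ right j j′`.
Fence : ∀ {n k} → Vec (Fin k) n → Side → Fin k → Fin k → Set
Fence {n} ℓ s j j′ = ∃[ w ] (lookup ℓ w ≡ j′ × ((v : Fin n) → lookup ℓ v ≡ j → w ⟨ s ⟩ v))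

NestedIn-irrefl : ∀ {n k} (ℓ : Vec (Fin k) n) {j} → ¬ NestedIn ℓ j j
NestedIn-irrefl ℓ ((w , ℓw≡j , w<) , _) = <⇒≢ (w< w ℓw≡j) refl

module Collapse {m n k} (f : Fin m → Fin n) (f-mono : ∀ {x y} → x Fin.≤ y → f x Fin.≤ f y)
                (f-surj : Surjective _≡_ _≡_ f)
                (ℓ : Vec (Fin k) n) (ℓ′ : Vec (Fin k) m)
                (ℓ′≗ℓ∘f : ∀ x → lookup ℓ′ x ≡ lookup ℓ (f x)) where

  private
    section : Fin n → Fin m
    section y = proj₁ (f-surj y)

    f∘section : ∀ y → f (section y) ≡ y
    f∘section y = proj₂ (f-surj y) refl

    ℓ′∘section : ∀ y → lookup ℓ′ (section y) ≡ lookup ℓ y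
    ℓ′∘section y = trans (ℓ′≗ℓ∘f _) (cong (lookup ℓ) (f∘section y))

    ℓ′-lift : ∀ {x y} → f x ≡ f y → lookup ℓ′ x ≡ lookup ℓ′ y
    ℓ′-lift {x} {y} e = trans (ℓ′≗ℓ∘f x) (trans (cong (lookup ℓ) e) (sym (ℓ′≗ℓ∘f y)))

    ℓ′-lower : ∀ {x y} → lookup ℓ′ x ≡ lookup ℓ′ y → lookup ℓ (f x) ≡ lookup ℓ (f y)
    ℓ′-lower {x} {y} e = trans (sym (ℓ′≗ℓ∘f x)) (trans e (ℓ′≗ℓ∘f y))

    f-strict : ∀ s {x y} → x ⟨ s ⟩ y → f x ≢ f y → f x ⟨ s ⟩ f y
    f-strict left  x<y fx≢fy = ≤∧≢⇒< (f-mono (ℕ.<⇒≤ x<y)) fx≢fy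
    f-strict right y<x fx≢fy = ≤∧≢⇒< (f-mono (ℕ.<⇒≤ y<x)) (fx≢fy ∘ sym)

    f-reflects-< : ∀ {x y} → f x < f y → x < y
    f-reflects-< fx<fy = ℕ.≰⇒> (λ y≤x → ℕ.<⇒≱ fx<fy (f-mono y≤x))

    f-reflects : ∀ s {x y} → f x ⟨ s ⟩ f y → x ⟨ s ⟩ y
    f-reflects left  = f-reflects-<
    f-reflects right = f-reflects-<

    section-mono-< : ∀ {x y} → x < y → section x < section y
    section-mono-< {x} {y} x<y = f-reflects-< (subst₂ _<_ (sym (f∘section x)) (sym (f∘section y)) x<y)

  surj⁺ : Surj ℓ → Surj ℓ′
  surj⁺ surj j = let (y , ℓy≡j) = surj j in section y , trans (ℓ′∘section y) ℓy≡j

  surj⁻ : Surj ℓ′ → Surj ℓ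
  surj⁻ surj j = let (x , ℓ′x≡j) = surj j in f x , trans (sym (ℓ′≗ℓ∘f x)) ℓ′x≡j

  nonCrossing⁺ : NonCrossing ℓ → NonCrossing ℓ′
  nonCrossing⁺ nc a b c d a<b b<c c<d ac bd with f a ≟ f b | f b ≟ f c | f c ≟ f d
  ... | yes fa≡fb | _         | _         = ℓ′-lift fa≡fb
  ... | no _      | yes fb≡fc | _         = trans ac (sym (ℓ′-lift fb≡fc))
  ... | no _      | no _      | yes fc≡fd = trans ac (trans (ℓ′-lift fc≡fd) (sym bd))
  ... | no fa≢fb  | no fb≢fc  | no fc≢fd  =
    trans (ℓ′≗ℓ∘f a) (trans (nc (f a) (f b) (f c) (f d)
      (f-strict left a<b fa≢fb) (f-strict left b<c fb≢fc) (f-strict left c<d fc≢fd)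
      (ℓ′-lower ac) (ℓ′-lower bd)) (sym (ℓ′≗ℓ∘f b)))

  nonCrossing⁻ : NonCrossing ℓ′ → NonCrossing ℓ
  nonCrossing⁻ nc a b c d a<b b<c c<d ac bd =
    trans (sym (ℓ′∘section a)) (trans (nc (section a) (section b) (section c) (section d)
      (section-mono-< a<b) (section-mono-< b<c) (section-mono-< c<d)
      (trans (ℓ′∘section a) (trans ac (sym (ℓ′∘section c))))
      (trans (ℓ′∘section b) (trans bd (sym (ℓ′∘section d))))) (ℓ′∘section b))

  fence⁻ : ∀ s {j j′} → j ≢ j′ → Fence ℓ′ s j j′ → Fence ℓ s j j′
  fence⁻ s {j} {j′} j≢j′ (w , ℓ′w≡j′ , beyond) =
    f w , trans (sym (ℓ′≗ℓ∘f w)) ℓ′w≡j′ , beyond⁻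
    where
    beyond⁻ : (v : Fin n) → lookup ℓ v ≡ j → f w ⟨ s ⟩ v
    beyond⁻ v ℓv≡j = subst (f w ⟨ s ⟩_) (f∘section v)
      (f-strict s (beyond (section v) (trans (ℓ′∘section v) ℓv≡j))
        (λ e → j≢j′ (trans (sym ℓv≡j)
                      (trans (sym (ℓ′∘section v)) (trans (sym (ℓ′-lift e)) ℓ′w≡j′)))))

  fence⁺ : ∀ s {j j′} → Fence ℓ s j j′ → Fence ℓ′ s j j′
  fence⁺ s (w , ℓw≡j′ , beyond) = section w , trans (ℓ′∘section w) ℓw≡j′ ,
    λ v ℓ′v≡j → f-reflects s (subst (_⟨ s ⟩ f v) (sym (f∘section w))
      (beyond (f v) (trans (sym (ℓ′≗ℓ∘f v)) ℓ′v≡j)))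

  monotonic⁺ : Monotonic ℓ → Monotonic ℓ′
  monotonic⁺ mono j j′ nested with j ≟ j′
  ... | yes refl  = ⊥-elim (NestedIn-irrefl ℓ′ nested)
  ... | no j≢j′   = mono j j′ (fence⁻ left j≢j′ (proj₁ nested) , fence⁻ right j≢j′ (proj₂ nested))

  monotonic⁻ : Monotonic ℓ′ → Monotonic ℓ
  monotonic⁻ mono j j′ (l , r) = mono j j′ (fence⁺ left l , fence⁺ right r)

  isNCmton⇔ : IsNCmton (k , ℓ) ⇔ IsNCmton (k , ℓ′)
  isNCmton⇔ = mk⇔ (λ (s , nc , mo) → surj⁺ s , nonCrossing⁺ nc , monotonic⁺ mo)
                  (λ (s , nc , mo) → surj⁻ s , nonCrossing⁻ nc , monotonic⁻ mo)

punchIn-mono : ∀ {n} (p : Fin (suc n)) s {i j : Fin n} → i ⟨ s ⟩ j → punchIn p i ⟨ s ⟩ punchIn p j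
punchIn-mono p left  = punchIn-mono-< p
punchIn-mono p right = punchIn-mono-< p

punchIn-cancel : ∀ {n} (p : Fin (suc n)) s {i j : Fin n} → punchIn p i ⟨ s ⟩ punchIn p j → i ⟨ s ⟩ j
punchIn-cancel p left  = punchIn-cancel-< p
punchIn-cancel p right = punchIn-cancel-< p

module SingletonTop {n k} (ℓ : Vec (Fin k) n) (p : Fin (suc n)) where

  ℓ⁺ : Vec (Fin (suc k)) (suc n)
  ℓ⁺ = insertAt (Vec.map inject₁ ℓ) p (fromℕ k)

  ℓ⁺-at-p : lookup ℓ⁺ p ≡ fromℕ k
  ℓ⁺-at-p = insertAt-lookup _ p _

  ℓ⁺-punchIn : ∀ j → lookup ℓ⁺ (punchIn p j) ≡ inject₁ (lookup ℓ j)
  ℓ⁺-punchIn j = trans (insertAt-punchIn _ p _ j) (lookup-map j inject₁ ℓ)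

  top-only-at-p : ∀ {x} → lookup ℓ⁺ x ≡ fromℕ k → x ≡ p
  top-only-at-p {x} ℓ⁺x≡top with punchView p x
  ... | at-p      = refl
  ... | punched j = ⊥-elim (fromℕ≢inject₁ (trans (sym ℓ⁺x≡top) (ℓ⁺-punchIn j)))

  private
    inject₁-preimage : ∀ {x c} → lookup ℓ⁺ x ≡ inject₁ c → ∃[ j ] (punchIn p j ≡ x × lookup ℓ j ≡ c)
    inject₁-preimage {x} ℓ⁺x≡c with punchView p x
    ... | at-p      = ⊥-elim (fromℕ≢inject₁ (trans (sym ℓ⁺-at-p) ℓ⁺x≡c))
    ... | punched j = j , refl , inject₁-injective (trans (sym (ℓ⁺-punchIn j)) ℓ⁺x≡c)

    shared-punched : ∀ {x y} → x ≢ y → lookup ℓ⁺ x ≡ lookup ℓ⁺ y → ∃[ j ] punchIn p j ≡ x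
    shared-punched {x} x≢y ℓ⁺x≡ℓ⁺y with punchView p x
    ... | at-p      = ⊥-elim (x≢y (sym (top-only-at-p (trans (sym ℓ⁺x≡ℓ⁺y) ℓ⁺-at-p))))
    ... | punched j = j , refl

    ℓ⁺-lower : ∀ {i j} → lookup ℓ⁺ (punchIn p i) ≡ lookup ℓ⁺ (punchIn p j) → lookup ℓ i ≡ lookup ℓ j
    ℓ⁺-lower {i} {j} e = inject₁-injective (trans (sym (ℓ⁺-punchIn i)) (trans e (ℓ⁺-punchIn j)))

    ℓ⁺-lift : ∀ {i j} → lookup ℓ i ≡ lookup ℓ j → lookup ℓ⁺ (punchIn p i) ≡ lookup ℓ⁺ (punchIn p j)
    ℓ⁺-lift {i} {j} e = trans (ℓ⁺-punchIn i) (trans (cong inject₁ e) (sym (ℓ⁺-punchIn j)))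

  surj⁺ : Surj ℓ → Surj ℓ⁺
  surj⁺ surj c with view c
  ... | ‵fromℕ      = p , ℓ⁺-at-p
  ... | ‵inject₁ c′ =
    let (j , ℓj≡c′) = surj c′ in punchIn p j , trans (ℓ⁺-punchIn j) (cong inject₁ ℓj≡c′)

  surj⁻ : Surj ℓ⁺ → Surj ℓ
  surj⁻ surj c = let (j , _ , ℓj≡c) = inject₁-preimage (proj₂ (surj (inject₁ c))) in j , ℓj≡c

  nonCrossing⁺ : NonCrossing ℓ → NonCrossing ℓ⁺
  nonCrossing⁺ nc a b c d a<b b<c c<d ac bd
    with shared-punched (<⇒≢ (<-trans a<b b<c)) ac
       | shared-punched (<⇒≢ (<-trans b<c c<d)) bd
       | shared-punched (<⇒≢ (<-trans a<b b<c) ∘ sym) (sym ac)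
       | shared-punched (<⇒≢ (<-trans b<c c<d) ∘ sym) (sym bd)
  ... | a′ , refl | b′ , refl | c′ , refl | d′ , refl =
    ℓ⁺-lift (nc a′ b′ c′ d′ (punchIn-cancel-< p a<b) (punchIn-cancel-< p b<c) (punchIn-cancel-< p c<d)
                (ℓ⁺-lower ac) (ℓ⁺-lower bd))

  nonCrossing⁻ : NonCrossing ℓ⁺ → NonCrossing ℓ
  nonCrossing⁻ nc a b c d a<b b<c c<d ac bd =
    ℓ⁺-lower (nc (punchIn p a) (punchIn p b) (punchIn p c) (punchIn p d)
      (punchIn-mono-< p a<b) (punchIn-mono-< p b<c) (punchIn-mono-< p c<d) (ℓ⁺-lift ac) (ℓ⁺-lift bd))

  fence⁻ : ∀ s {c c′} → Fence ℓ⁺ s (inject₁ c) (inject₁ c′) → Fence ℓ s c c′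
  fence⁻ s (w , ℓ⁺w≡c′ , beyond) with inject₁-preimage ℓ⁺w≡c′
  ... | w′ , refl , ℓw′≡c′ = w′ , ℓw′≡c′ ,
    λ v ℓv≡c → punchIn-cancel p s (beyond (punchIn p v) (trans (ℓ⁺-punchIn v) (cong inject₁ ℓv≡c)))

  fence⁺ : ∀ s {c c′} → Fence ℓ s c c′ → Fence ℓ⁺ s (inject₁ c) (inject₁ c′)
  fence⁺ s {c} (w , ℓw≡c′ , beyond) = punchIn p w , trans (ℓ⁺-punchIn w) (cong inject₁ ℓw≡c′) , beyond⁺
    where
    beyond⁺ : ∀ v → lookup ℓ⁺ v ≡ inject₁ c → punchIn p w ⟨ s ⟩ v
    beyond⁺ v ℓ⁺v≡c with inject₁-preimage ℓ⁺v≡c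
    ... | v′ , refl , ℓv′≡c = punchIn-mono p s (beyond v′ ℓv′≡c)

  monotonic⁺ : Surj ℓ → Monotonic ℓ → Monotonic ℓ⁺
  monotonic⁺ surj mono j j′ nested with view j | view j′
  ... | ‵fromℕ     | ‵fromℕ      = ⊥-elim (NestedIn-irrefl ℓ⁺ nested)
  ... | ‵fromℕ     | ‵inject₁ c′ = inject₁<fromℕ c′
  ... | ‵inject₁ c | ‵inject₁ c′ =
    inject₁-mono-< (mono c c′ (fence⁻ left (proj₁ nested) , fence⁻ right (proj₂ nested)))
  ... | ‵inject₁ c | ‵fromℕ      =
    let (v , ℓ⁺v≡c) = surj⁺ surj (inject₁ c)
        ((w₁ , ℓ⁺w₁≡top , w₁<) , (w₂ , ℓ⁺w₂≡top , <w₂)) = nested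
    in ⊥-elim (<-asym (subst (_< v) (top-only-at-p ℓ⁺w₁≡top) (w₁< v ℓ⁺v≡c))
                      (subst (v <_) (top-only-at-p ℓ⁺w₂≡top) (<w₂ v ℓ⁺v≡c)))

  monotonic⁻ : Monotonic ℓ⁺ → Monotonic ℓ
  monotonic⁻ mono c c′ (l , r) =
    inject₁-cancel-< (mono (inject₁ c) (inject₁ c′) (fence⁺ left l , fence⁺ right r))

  isNCmton⇔ : IsNCmton (k , ℓ) ⇔ IsNCmton (suc k , ℓ⁺)
  isNCmton⇔ = mk⇔ (λ (s , nc , mo) → surj⁺ s , nonCrossing⁺ nc , monotonic⁺ s mo)
                  (λ (s , nc , mo) → surj⁻ s , nonCrossing⁻ nc , monotonic⁻ mo)

between-nested : ∀ {n k} (ℓ : Vec (Fin k) n) → NonCrossing ℓ → ∀ {q y x} → q < y → y < x →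
                 lookup ℓ q ≡ lookup ℓ x → lookup ℓ y ≢ lookup ℓ q → NestedIn ℓ (lookup ℓ y) (lookup ℓ q)
between-nested ℓ nc {q} {y} {x} q<y y<x qx y≢q = (q , refl , after-q) , (x , sym qx , before-x)
  where
  after-q : ∀ v → lookup ℓ v ≡ lookup ℓ y → q < v
  after-q v vy with <-cmp q v
  ... | tri< q<v _ _ = q<v
  ... | tri≈ _ refl _ = ⊥-elim (y≢q (sym vy))
  ... | tri> _ _ v<q = ⊥-elim (y≢q (trans (sym vy) (nc v q y x v<q q<y y<x vy qx)))
  before-x : ∀ v → lookup ℓ v ≡ lookup ℓ y → v < x
  before-x v vy with <-cmp v x
  ... | tri< v<x _ _ = v<x
  ... | tri≈ _ refl _ = ⊥-elim (y≢q (trans (sym vy) (sym qx)))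
  ... | tri> _ _ x<v = ⊥-elim (y≢q (sym (nc q y x v q<y y<x x<v qx (sym vy))))

top-block-convex : ∀ {n k} (ℓ : Vec (Fin (suc k)) n) → NonCrossing ℓ → Monotonic ℓ →
                   ∀ {q y x} → q < y → y < x →
                   lookup ℓ q ≡ fromℕ k → lookup ℓ x ≡ fromℕ k → lookup ℓ y ≡ fromℕ k
top-block-convex {k = k} ℓ nc mono {q} {y} q<y y<x ℓq≡top ℓx≡top with lookup ℓ y ≟ fromℕ k
... | yes ℓy≡top = ℓy≡top
... | no ℓy≢top  = ⊥-elim (fromℕ≮ (lookup ℓ y) (subst (_< lookup ℓ y) ℓq≡top (mono _ _ nested)))
  where
  nested : NestedIn ℓ (lookup ℓ y) (lookup ℓ q)
  nested = between-nested ℓ nc q<y y<x (trans ℓq≡top (sym ℓx≡top))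
                          (λ ℓy≡ℓq → ℓy≢top (trans ℓy≡ℓq ℓq≡top))

pinch-inject₁ : ∀ {n} (i : Fin n) → pinch i (inject₁ i) ≡ i
pinch-inject₁ zero    = refl
pinch-inject₁ (suc i) = cong suc (pinch-inject₁ i)

pinch-suc : ∀ {n} (i : Fin n) → pinch i (suc i) ≡ i
pinch-suc zero    = refl
pinch-suc (suc i) = cong suc (pinch-suc i)

factor-through-pinch : ∀ {a} {A : Set a} {m} (f : Fin (suc (suc m)) → A) (i : Fin (suc m)) →
                       f (inject₁ i) ≡ f (suc i) → ∀ y → f y ≡ f (punchIn (suc i) (pinch i y))
factor-through-pinch f zero    fi≡fi+1 zero          = refl
factor-through-pinch f zero    fi≡fi+1 (suc zero)    = sym fi≡fi+1
factor-through-pinch f zero    fi≡fi+1 (suc (suc y)) = refl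
factor-through-pinch f (suc i) fi≡fi+1 zero          = refl
factor-through-pinch {m = suc m} f (suc i) fi≡fi+1 (suc y) = factor-through-pinch (f ∘ suc) i fi≡fi+1 y

removeAt-punchIn : ∀ {a} {A : Set a} {n} (xs : Vec A (suc n)) (i : Fin (suc n)) (j : Fin n) →
                   lookup (removeAt xs i) j ≡ lookup xs (punchIn i j)
removeAt-punchIn xs i j = trans (sym (insertAt-punchIn (removeAt xs i) i (lookup xs i) j))
                                (cong (λ ys → lookup ys (punchIn i j)) (insertAt-removeAt xs i))

module FirstOccurrence {a} {A : Set a} (_≟ᴬ_ : DecidableEquality A) (c : A) where

  IsFirst : ∀ {n} → Vec A n → Fin n → Set a
  IsFirst ℓ q = lookup ℓ q ≡ c × (∀ {z} → z < q → lookup ℓ z ≢ c)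

  first : ∀ {n} (ℓ : Vec A n) → ∃[ i ] lookup ℓ i ≡ c → ∃ (IsFirst ℓ)
  first (a ∷ ℓ) occurs with a ≟ᴬ c | occurs
  ... | yes a≡c | _             = zero , a≡c , λ ()
  ... | no a≢c  | zero , a≡c    = ⊥-elim (a≢c a≡c)
  ... | no a≢c  | suc i , ℓi≡c  with first ℓ (i , ℓi≡c)
  ...   | q , ℓq≡c , before-q = suc q , ℓq≡c , λ { {zero} _ → a≢c ; {suc z} (s≤s z<q) → before-q z<q }

  -- If c does not occur it is appended; a junk case, since valid labellings contain their top label.
  duplicateFirst : ∀ {n} → Vec A n → Vec A (suc n)
  duplicateFirst []      = c ∷ []
  duplicateFirst (a ∷ ℓ) with a ≟ᴬ c
  ... | yes _ = a ∷ a ∷ ℓ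
  ... | no _  = a ∷ duplicateFirst ℓ

  duplicateFirst-injective : ∀ {n} {ℓ₁ ℓ₂ : Vec A n} → duplicateFirst ℓ₁ ≡ duplicateFirst ℓ₂ → ℓ₁ ≡ ℓ₂
  duplicateFirst-injective {ℓ₁ = []}     {[]}     _ = refl
  duplicateFirst-injective {ℓ₁ = a ∷ ℓ₁} {b ∷ ℓ₂} e with a ≟ᴬ c | b ≟ᴬ c
  ... | yes _   | yes _   = cong₂ _∷_ (∷-injectiveˡ e) (∷-injectiveʳ (∷-injectiveʳ e))
  ... | yes a≡c | no b≢c  = ⊥-elim (b≢c (trans (sym (∷-injectiveˡ e)) a≡c))
  ... | no a≢c  | yes b≡c = ⊥-elim (a≢c (trans (∷-injectiveˡ e) b≡c))
  ... | no _    | no _    = cong₂ _∷_ (∷-injectiveˡ e) (duplicateFirst-injective (∷-injectiveʳ e))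

  duplicateFirst-pinch : ∀ {n} (ℓ : Vec A n) {q} → IsFirst ℓ q →
                         ∀ y → lookup (duplicateFirst ℓ) y ≡ lookup ℓ (pinch q y)
  duplicateFirst-pinch (a ∷ ℓ) {q} (ℓq≡c , before-q) y with a ≟ᴬ c | q | y
  ... | yes a≡c | suc _ | _      = ⊥-elim (before-q {zero} (s≤s z≤n) a≡c)
  ... | yes _   | zero  | zero   = refl
  ... | yes _   | zero  | suc y′ = refl
  ... | no a≢c  | zero  | _      = ⊥-elim (a≢c ℓq≡c)
  ... | no _    | suc _ | zero   = refl
  ... | no _    | suc q′ | suc y′ = duplicateFirst-pinch ℓ {q′} (ℓq≡c , before-q ∘ s≤s) y′

  duplicateFirst-removeAt : ∀ {m} {ℓ : Vec A (suc (suc m))} {i} →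
                            IsFirst ℓ (inject₁ i) → lookup ℓ (suc i) ≡ c →
                            duplicateFirst (removeAt ℓ (suc i)) ≡ ℓ
  duplicateFirst-removeAt {ℓ = a ∷ b ∷ ℓ} {zero} (a≡c , _) b≡c with a ≟ᴬ c
  ... | yes _   = cong (λ x → a ∷ x ∷ ℓ) (trans a≡c (sym b≡c))
  ... | no a≢c  = ⊥-elim (a≢c a≡c)
  duplicateFirst-removeAt {m = suc m} {ℓ = a ∷ b ∷ ℓ} {suc i} (ℓi≡c , before-i) ℓi+1≡c with a ≟ᴬ c
  ... | yes a≡c = ⊥-elim (before-i {zero} (s≤s z≤n) a≡c)
  ... | no _    = cong (a ∷_) (duplicateFirst-removeAt {i = i} (ℓi≡c , before-i ∘ s≤s) ℓi+1≡c)

module TopOccurrence {k} = FirstOccurrence (_≟_ {suc k}) (fromℕ k)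
open TopOccurrence
  using (IsFirst; first; duplicateFirst; duplicateFirst-injective; duplicateFirst-pinch; duplicateFirst-removeAt)

addSingleton : ∀ {n} → Fin (suc n) → Labelling n → Labelling (suc n)
addSingleton p (k , ℓ) = suc k , SingletonTop.ℓ⁺ ℓ p

enlargeTop : ∀ {n} → Labelling (suc n) → Labelling (suc (suc n))
enlargeTop (zero  , () ∷ _)
enlargeTop (suc k , ℓ) = suc k , duplicateFirst ℓ

enlargeTop-blocks : ∀ {n} (x : Labelling (suc n)) → proj₁ (enlargeTop x) ≡ proj₁ x
enlargeTop-blocks (zero  , () ∷ _)
enlargeTop-blocks (suc k , ℓ) = refl

addSingleton-isNCmton⇔ : ∀ {n} (p : Fin (suc n)) (x : Labelling n) → IsNCmton x ⇔ IsNCmton (addSingleton p x)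
addSingleton-isNCmton⇔ p (k , ℓ) = SingletonTop.isNCmton⇔ ℓ p

map-injective : ∀ {a b} {A : Set a} {B : Set b} {f : A → B} → (∀ {x y} → f x ≡ f y → x ≡ y) →
                ∀ {n} {xs ys : Vec A n} → Vec.map f xs ≡ Vec.map f ys → xs ≡ ys
map-injective f-inj {xs = []}     {[]}     _ = refl
map-injective f-inj {xs = x ∷ xs} {y ∷ ys} e =
  cong₂ _∷_ (f-inj (∷-injectiveˡ e)) (map-injective f-inj (∷-injectiveʳ e))

avoids-top⇒map-inject₁ : ∀ {n k} (xs : Vec (Fin (suc k)) n) → (∀ j → lookup xs j ≢ fromℕ k) →
                         ∃[ ys ] Vec.map inject₁ ys ≡ xs
avoids-top⇒map-inject₁ []       _     = [] , refl
avoids-top⇒map-inject₁ (x ∷ xs) avoid with view x | avoids-top⇒map-inject₁ xs (avoid ∘ suc)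
... | ‵fromℕ     | _         = ⊥-elim (avoid zero refl)
... | ‵inject₁ y | ys , refl = y ∷ ys , refl

enlargeTop-isNCmton : ∀ {n} (x : Labelling (suc n)) → IsNCmton x → IsNCmton (enlargeTop x)
enlargeTop-isNCmton (zero  , () ∷ _) _
enlargeTop-isNCmton (suc k , ℓ) valid@(surj , _) =
  let (q , q-first) = first ℓ (surj (fromℕ k))
  in Equivalence.to (Collapse.isNCmton⇔ (pinch q) (pinch-mono-≤ q) (pinch-surjective q)
                                          ℓ (duplicateFirst ℓ) (duplicateFirst-pinch ℓ q-first)) valid

addSingleton-injective : ∀ {n} {p p′ : Fin (suc n)} {x y} →
                         addSingleton p x ≡ addSingleton p′ y → p ≡ p′ × x ≡ y
addSingleton-injective {p = p} {p′} {k , ℓ} {k′ , ℓ′} e with ℕ.suc-injective (,-injectiveˡ e)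
... | refl = p≡p′ , cong (k ,_) (map-injective inject₁-injective map≡map)
  where
  open SingletonTop using (ℓ⁺)
  open ≡-Reasoning
  ℓ⁺≡ℓ′⁺ : ℓ⁺ ℓ p ≡ ℓ⁺ ℓ′ p′
  ℓ⁺≡ℓ′⁺ = ,-injectiveʳ e
  p≡p′ : p ≡ p′
  p≡p′ = sym (SingletonTop.top-only-at-p ℓ p
                (trans (cong (λ v → lookup v p′) ℓ⁺≡ℓ′⁺) (SingletonTop.ℓ⁺-at-p ℓ′ p′)))
  map≡map : Vec.map inject₁ ℓ ≡ Vec.map inject₁ ℓ′
  map≡map = begin
    Vec.map inject₁ ℓ    ≡⟨ removeAt-insertAt _ p _ ⟨
    removeAt (ℓ⁺ ℓ p) p    ≡⟨ cong₂ removeAt ℓ⁺≡ℓ′⁺ p≡p′ ⟩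
    removeAt (ℓ⁺ ℓ′ p′) p′ ≡⟨ removeAt-insertAt _ p′ _ ⟩
    Vec.map inject₁ ℓ′   ∎

enlargeTop-injective : ∀ {n} {x y : Labelling (suc n)} → enlargeTop x ≡ enlargeTop y → x ≡ y
enlargeTop-injective {x = zero , () ∷ _} _
enlargeTop-injective {y = zero , () ∷ _} _
enlargeTop-injective {x = suc k , ℓ} {suc k′ , ℓ′} e with ℕ.suc-injective (,-injectiveˡ e)
... | refl = cong (suc k ,_) (duplicateFirst-injective (,-injectiveʳ e))

-- `addSingleton` has a single top position, `enlargeTop` duplicates one.
addSingleton≢enlargeTop : ∀ {n} (p : Fin (suc (suc n))) x y → IsNCmton y → addSingleton p x ≢ enlargeTop y
addSingleton≢enlargeTop p x (zero , () ∷ _) _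
addSingleton≢enlargeTop p (k , ℓ) (suc k′ , ℓ′) (surj , _) e
  with ℕ.suc-injective (,-injectiveˡ e) | first ℓ′ (surj (fromℕ k′))
... | refl | q , q-first =
  <⇒≢ (≤̄⇒inject₁< ≤-refl) (trans (top-at (pinch-inject₁ q)) (sym (top-at (pinch-suc q))))
  where
  open ≡-Reasoning
  top-at : ∀ {y} → pinch q y ≡ q → y ≡ p
  top-at {y} pinch-y≡q = SingletonTop.top-only-at-p ℓ p (begin
    lookup (SingletonTop.ℓ⁺ ℓ p) y ≡⟨ cong (λ v → lookup v y) (,-injectiveʳ e) ⟩
    lookup (duplicateFirst ℓ′) y   ≡⟨ duplicateFirst-pinch ℓ′ q-first y ⟩
    lookup ℓ′ (pinch q y)          ≡⟨ cong (lookup ℓ′) pinch-y≡q ⟩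
    lookup ℓ′ q                    ≡⟨ proj₁ q-first ⟩
    fromℕ k                        ∎)

module _ {m k} (ℓ : Vec (Fin (suc k)) (suc m)) where

  remove-singleton-top : ∀ {q} → lookup ℓ q ≡ fromℕ k → (∀ {z} → lookup ℓ z ≡ fromℕ k → z ≡ q) →
                         ∃[ ℓ₀ ] (suc k , ℓ) ≡ addSingleton q (k , ℓ₀)
  remove-singleton-top {q} ℓq≡top only-q
    with avoids-top⇒map-inject₁ (removeAt ℓ q)
           (λ j e → punchInᵢ≢i q j (only-q (trans (sym (removeAt-punchIn ℓ q j)) e)))
  ... | ℓ₀ , map-ℓ₀≡ = ℓ₀ , cong (suc k ,_) (begin
    ℓ                                          ≡⟨ insertAt-removeAt ℓ q ⟨
    insertAt (removeAt ℓ q) q (lookup ℓ q)     ≡⟨ cong₂ (λ xs x → insertAt xs q x) (sym map-ℓ₀≡) ℓq≡top ⟩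
    insertAt (Vec.map inject₁ ℓ₀) q (fromℕ k)  ∎)
    where open ≡-Reasoning

  singleton-top-case : IsNCmton (suc k , ℓ) →
                       ∀ {q} → lookup ℓ q ≡ fromℕ k → (∀ {z} → lookup ℓ z ≡ fromℕ k → z ≡ q) →
                       ∃[ y ] (IsNCmton y × (suc k , ℓ) ≡ addSingleton q y)
  singleton-top-case valid {q} ℓq≡top only-q =
    let (ℓ₀ , ℓ≡ℓ₀⁺) = remove-singleton-top ℓq≡top only-q
    in (k , ℓ₀) ,
       Equivalence.from (addSingleton-isNCmton⇔ q (k , ℓ₀)) (subst IsNCmton ℓ≡ℓ₀⁺ valid) ,
       ℓ≡ℓ₀⁺

module _ {m k} (ℓ : Vec (Fin (suc k)) (suc (suc m))) where

  first-top-repeated : NonCrossing ℓ → Monotonic ℓ →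
                       ∀ {q z} → IsFirst ℓ q → lookup ℓ z ≡ fromℕ k → z ≢ q →
                       ∃[ i ] (IsFirst ℓ (inject₁ i) × lookup ℓ (suc i) ≡ fromℕ k)
  first-top-repeated nc mono {q} {z} q-first@(ℓq≡top , before-q) ℓz≡top z≢q with <-cmp q z
  ... | tri≈ _ q≡z _ = ⊥-elim (z≢q (sym q≡z))
  ... | tri> _ _ z<q = ⊥-elim (before-q z<q ℓz≡top)
  ... | tri< q<z _ _ with view q
  ...   | ‵fromℕ     = ⊥-elim (fromℕ≮ z q<z)
  ...   | ‵inject₁ i = i , q-first , ℓi+1≡top
    where
    ℓi+1≡top : lookup ℓ (suc i) ≡ fromℕ k
    ℓi+1≡top with suc i ≟ z
    ... | yes refl  = ℓz≡top
    ... | no i+1≢z = top-block-convex ℓ nc mono (≤̄⇒inject₁< ≤-refl)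
                       (≤∧≢⇒< (subst (λ t → suc t ℕ.≤ toℕ z) (toℕ-inject₁ i) q<z) i+1≢z) ℓq≡top ℓz≡top

  enlarged-top-case : IsNCmton (suc k , ℓ) → ∀ {i} → IsFirst ℓ (inject₁ i) → lookup ℓ (suc i) ≡ fromℕ k →
                      ∃[ y ] (IsNCmton y × (suc k , ℓ) ≡ enlargeTop y)
  enlarged-top-case valid {i} i-first ℓi+1≡top =
    (suc k , removeAt ℓ (suc i)) ,
    Equivalence.from (Collapse.isNCmton⇔ (pinch i) (pinch-mono-≤ i) (pinch-surjective i) (removeAt ℓ (suc i)) ℓ ℓ≗)
                     valid ,
    cong (suc k ,_) (sym (duplicateFirst-removeAt i-first ℓi+1≡top))
    where
    ℓ≗ : ∀ y → lookup ℓ y ≡ lookup (removeAt ℓ (suc i)) (pinch i y)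
    ℓ≗ y = trans (factor-through-pinch (lookup ℓ) i (trans (proj₁ i-first) (sym ℓi+1≡top)) y)
                 (sym (removeAt-punchIn ℓ (suc i) (pinch i y)))

decompose : ∀ {m} (x : Labelling (suc (suc m))) → IsNCmton x →
            (∃₂ λ p y → IsNCmton y × x ≡ addSingleton p y) ⊎ (∃ λ y → IsNCmton y × x ≡ enlargeTop y)
decompose (zero , () ∷ _) _
decompose (suc k , ℓ) valid@(surj , nc , mono) with first ℓ (surj (fromℕ k))
... | q , q-first with any? (λ z → ¬? (z ≟ q) ×-dec (lookup ℓ z ≟ fromℕ k))
...   | yes (z , z≢q , ℓz≡top) =
  let (i , i-first , ℓi+1≡top) = first-top-repeated ℓ nc mono q-first ℓz≡top z≢q
  in inj₂ (enlarged-top-case ℓ valid i-first ℓi+1≡top)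
...   | no no-other =
  inj₁ (q , singleton-top-case ℓ valid (proj₁ q-first)
              (λ {z} ℓz≡top → decidable-stable (z ≟ q) (λ z≢q → no-other (z , z≢q , ℓz≡top))))

extend : ∀ {n} → List (Labelling (suc n)) → List (Labelling (suc (suc n)))
extend L = cartesianProductWith addSingleton (allFin _) L ++ map enlargeTop L

extend-isEnumeration : ∀ {n} {L : List (Labelling (suc n))} → IsEnumeration L → IsEnumeration (extend L)
extend-isEnumeration {n} {L} (unique , valid , complete) =
  Unique.++⁺ (Unique.cartesianProductWith⁺ addSingleton addSingleton-injective (Unique.allFin⁺ _) unique)
             (Unique.map⁺ enlargeTop-injective unique) disjoint ,
  All.tabulate valid⁺ , complete⁺
  where
  singletons : List (Labelling (suc (suc n)))
  singletons = cartesianProductWith addSingleton (allFin (suc (suc n))) L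

  disjoint : ∀ {v} → ¬ (v ∈ singletons × v ∈ map enlargeTop L)
  disjoint (v∈S , v∈E) with ∈-cartesianProductWith⁻ addSingleton (allFin _) L v∈S | ∈-map⁻ enlargeTop v∈E
  ... | p , x , _ , _ , refl | y , y∈L , e = addSingleton≢enlargeTop p x y (All.lookup valid y∈L) e

  valid⁺ : ∀ {v} → v ∈ extend L → IsNCmton v
  valid⁺ v∈ with ∈-++⁻ singletons v∈
  ... | inj₁ v∈S with ∈-cartesianProductWith⁻ addSingleton (allFin _) L v∈S
  ...   | p , x , _ , x∈L , refl = Equivalence.to (addSingleton-isNCmton⇔ p x) (All.lookup valid x∈L)
  valid⁺ v∈ | inj₂ v∈E with ∈-map⁻ enlargeTop v∈E
  ...   | y , y∈L , refl = enlargeTop-isNCmton y (All.lookup valid y∈L)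

  complete⁺ : ∀ x → IsNCmton x → x ∈ extend L
  complete⁺ x valid-x with decompose x valid-x
  ... | inj₁ (p , y , valid-y , refl) =
    ∈-++⁺ˡ (∈-cartesianProductWith⁺ addSingleton (∈-allFin p) (complete y valid-y))
  ... | inj₂ (y , valid-y , refl) = ∈-++⁺ʳ singletons (∈-map⁺ enlargeTop (complete y valid-y))

point : Labelling 1
point = 1 , zero ∷ []

point-isEnumeration : IsEnumeration (point ∷ [])
point-isEnumeration = All.[] AllPairs.∷ AllPairs.[] , valid All.∷ All.[] , λ x valid-x → here (only x valid-x)
  where
  valid : IsNCmton point
  valid = (λ { zero → zero , refl }) ,
          (λ { zero zero _ _ () }) ,
          (λ { zero zero nested → ⊥-elim (NestedIn-irrefl (zero ∷ []) nested) })
  only : ∀ x → IsNCmton x → x ≡ point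
  only (zero , () ∷ [])
  only (suc zero , zero ∷ []) _ = refl
  only (suc (suc k) , a ∷ []) (surj , _) with surj zero | surj (suc zero)
  ... | zero , refl | zero , ()

enumerations-↭ : ∀ {n} {L L′ : List (Labelling n)} → IsEnumeration L → IsEnumeration L′ → L ↭ L′
enumerations-↭ (unique , valid , complete) (unique′ , valid′ , complete′) =
  ∼bag⇒↭ (unique∧set⇒bag unique unique′ (mk⇔ (λ x∈L → complete′ _ (All.lookup valid x∈L))
                                               (λ x∈L′ → complete _ (All.lookup valid′ x∈L′))))

enumeration : ∀ m → Σ (List (Labelling (suc m))) IsEnumeration
enumeration zero    = point ∷ [] , point-isEnumeration
enumeration (suc m) = let (L , L-enum) = enumeration m in extend L , extend-isEnumeration L-enum

module Sums {c ℓ} (R : CommutativeSemiring c ℓ) (t : CommutativeSemiring.Carrier R) where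

  open CommutativeSemiring R
    renaming (refl to ≈-refl; sym to ≈-sym; trans to ≈-trans; reflexive to ≈-reflexive)
  open SetoidReasoning setoid

  Bsum-↭ : ∀ {n} {xs ys : List (Labelling n)} → xs ↭ ys → Bsum R t xs ≈ Bsum R t ys
  Bsum-↭ {xs = xs} {ys} xs↭ys = begin
    Bsum R t xs                   ≡⟨ foldr-map _+_ weight 0# xs ⟨
    foldr _+_ 0# (map weight xs)  ≈⟨ ↭ₛ.foldr-commMonoid setoid +-isCommutativeMonoid
                                       (↭⇒↭ₛ′ isEquivalence (↭.map⁺ weight xs↭ys)) ⟩
    foldr _+_ 0# (map weight ys)  ≡⟨ foldr-map _+_ weight 0# ys ⟩
    Bsum R t ys                   ∎
    where
    weight : Labelling _ → Carrier
    weight x = pow R t (proj₁ x)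

  Bsum-++ : ∀ {n} (xs ys : List (Labelling n)) → Bsum R t (xs ++ ys) ≈ Bsum R t xs + Bsum R t ys
  Bsum-++ []       ys = ≈-sym (+-identityˡ _)
  Bsum-++ (x ∷ xs) ys = ≈-trans (+-congˡ (Bsum-++ xs ys)) (≈-sym (+-assoc _ _ _))

  Bsum-addSingleton : ∀ {n} (p : Fin (suc n)) (L : List (Labelling n)) →
                      Bsum R t (map (addSingleton p) L) ≈ t * Bsum R t L
  Bsum-addSingleton p []       = ≈-sym (zeroʳ t)
  Bsum-addSingleton p (x ∷ L) = ≈-trans (+-congˡ (Bsum-addSingleton p L)) (≈-sym (distribˡ t _ _))

  Bsum-singletons : ∀ {n} (ps : List (Fin (suc n))) (L : List (Labelling n)) →
                    Bsum R t (cartesianProductWith addSingleton ps L) ≈ times R (length ps) t * Bsum R t L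
  Bsum-singletons []       L = ≈-sym (zeroˡ _)
  Bsum-singletons (p ∷ ps) L = begin
    Bsum R t (map (addSingleton p) L ++ cartesianProductWith addSingleton ps L)
      ≈⟨ Bsum-++ (map (addSingleton p) L) _ ⟩
    Bsum R t (map (addSingleton p) L) + Bsum R t (cartesianProductWith addSingleton ps L)
      ≈⟨ +-cong (Bsum-addSingleton p L) (Bsum-singletons ps L) ⟩
    t * Bsum R t L + times R (length ps) t * Bsum R t L
      ≈⟨ distribʳ _ t _ ⟨
    (t + times R (length ps) t) * Bsum R t L ∎

  Bsum-enlargeTop : ∀ {n} (L : List (Labelling (suc n))) → Bsum R t (map enlargeTop L) ≈ Bsum R t L
  Bsum-enlargeTop []      = ≈-refl
  Bsum-enlargeTop (x ∷ L) = +-cong (≈-reflexive (cong (pow R t) (enlargeTop-blocks x))) (Bsum-enlargeTop L)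

  Bsum-extend : ∀ {n} (L : List (Labelling (suc n))) → Bsum R t (extend L) ≈ (1# + times R (suc (suc n)) t) * Bsum R t L
  Bsum-extend {n} L = begin
    Bsum R t (extend L)
      ≈⟨ Bsum-++ (cartesianProductWith addSingleton (allFin _) L) _ ⟩
    Bsum R t (cartesianProductWith addSingleton (allFin _) L) + Bsum R t (map enlargeTop L)
      ≈⟨ +-cong (Bsum-singletons (allFin _) L) (Bsum-enlargeTop L) ⟩
    times R (length (allFin (suc (suc n)))) t * Bsum R t L + Bsum R t L
      ≡⟨ cong (λ k → times R k t * Bsum R t L + Bsum R t L) (length-tabulate {n = suc (suc n)} (λ i → i)) ⟩
    times R (suc (suc n)) t * Bsum R t L + Bsum R t L
      ≈⟨ +-cong ≈-refl (*-identityˡ _) ⟨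
    times R (suc (suc n)) t * Bsum R t L + 1# * Bsum R t L
      ≈⟨ +-comm _ _ ⟩
    1# * Bsum R t L + times R (suc (suc n)) t * Bsum R t L
      ≈⟨ distribʳ _ 1# _ ⟨
    (1# + times R (suc (suc n)) t) * Bsum R t L ∎

  Bsum-recurrence : ∀ {n} {L : List (Labelling (suc (suc n)))} {L′ : List (Labelling (suc n))} →
                    IsEnumeration L → IsEnumeration L′ → Bsum R t L ≈ (1# + times R (suc (suc n)) t) * Bsum R t L′
  Bsum-recurrence {L′ = L′} L-enum L′-enum =
    ≈-trans (Bsum-↭ (enumerations-↭ L-enum (extend-isEnumeration L′-enum))) (Bsum-extend L′)

  Bsum-closedForm : ∀ m {L : List (Labelling (suc m))} → IsEnumeration L → Bsum R t L ≈ closedForm R t (suc m)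
  Bsum-closedForm zero {L} L-enum = begin
    Bsum R t L   ≈⟨ Bsum-↭ (enumerations-↭ L-enum point-isEnumeration) ⟩
    t * 1# + 0#  ≈⟨ +-identityʳ _ ⟩
    t * 1#       ≈⟨ *-identityʳ t ⟩
    t            ∎
  Bsum-closedForm (suc m) {L} L-enum =
    let (L′ , L′-enum) = enumeration m in begin
    Bsum R t L                                               ≈⟨ Bsum-recurrence L-enum L′-enum ⟩
    (1# + times R (suc (suc m)) t) * Bsum R t L′             ≈⟨ *-congˡ (Bsum-closedForm m L′-enum) ⟩
    (1# + times R (suc (suc m)) t) * closedForm R t (suc m)  ≈⟨ *-comm _ _ ⟩
    closedForm R t (suc (suc m))                             ∎

lemma4p2 : ∀ {c ℓ : Level} (R : CommutativeSemiring c ℓ) (t : CommutativeSemiring.Carrier R) →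
    ((n : ℕ) → 2 ≤ n →
      (L : List (Labelling n)) → IsEnumeration L →
      (L' : List (Labelling (n ∸ 1))) → IsEnumeration L' →
      CommutativeSemiring._≈_ R (Bsum R t L)
        (CommutativeSemiring._*_ R
          (CommutativeSemiring._+_ R (CommutativeSemiring.1# R) (times R n t))
          (Bsum R t L')))
    ×
    ((n : ℕ) → 2 ≤ n →
      (L : List (Labelling n)) → IsEnumeration L →
      CommutativeSemiring._≈_ R (Bsum R t L) (closedForm R t n))
lemma4p2 R t = recurrence , closed
  where
  open CommutativeSemiring R using (_≈_; _+_; _*_; 1#)
  open Sums R t

  recurrence : (n : ℕ) → 2 ≤ n → (L : List (Labelling n)) → IsEnumeration L →
               (L′ : List (Labelling (n ∸ 1))) → IsEnumeration L′ → Bsum R t L ≈ (1# + times R n t) * Bsum R t L′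
  recurrence (suc (suc n)) (s≤s (s≤s z≤n)) L L-enum L′ L′-enum = Bsum-recurrence L-enum L′-enum

  closed : (n : ℕ) → 2 ≤ n → (L : List (Labelling n)) → IsEnumeration L → Bsum R t L ≈ closedForm R t n
  closed (suc (suc n)) (s≤s (s≤s z≤n)) L L-enum = Bsum-closedForm (suc n) L-enum
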